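{- For every WALT deduction $\Pi$: (1) $w_d(\Pi)\le |\Pi|_d$ for every $0\le d\le \partial(\Pi)$; (2) if $\Pi$ is a deduction of $\Gamma;\Delta;\mathcal{E}\vdash M:A$, then $|M|\le\sum_{d=0}^{\partial(\Pi)}|\Pi|_d$.
   Context: WALT (Weak Affine Light Typing) is the following type assignment system for pure $\lambda$-terms $M::=x\mid \lambda x.M\mid MN$. Formulas: $A::=L\mid !A\mid \$A$ and $L::=\alpha\mid A\multimap A\mid \$A\multimap_{e}A\mid \forall\alpha.L$ (formulas generated by $L$ are linear). Judgments are $\Gamma;\Delta;\mathcal{E}\vdash M:A$ where $\Gamma,\Delta$ are sets of type assignments $x:B$ and $\mathcal{E}$ is a finite set of pairs $(\Theta;\Phi)$, $\Theta$ a set of type assignments and $\Phi$ empty or a singleton, with at most one pair having $\Phi=\emptyset$ and the variables of distinct $\Phi$'s distinct. $\mathcal{E}_M\sqcup\mathcal{E}_N$ is $\{(\Theta_M\cup\Theta_N;\Phi)\mid(\Theta_M;\Phi)\in\mathcal{E}_M,(\Theta_N;\Phi)\in\mathcal{E}_N\}$ together with the pairs of either context whose second component is not the second component of a pair of the other; $\mathcal{E}\sqcup\{(\emptyset;\emptyset)\}=\mathcal{E}\sqcup\emptyset=\mathcal{E}$. $\mathcal{E},(\Theta;\Phi)$ denotes $\mathcal{E}\cup\{(\Theta;\Phi)\}$ with $(\Theta;\Phi)\notin\mathcal{E}$; $\$\Delta$ is $\Delta$ with each type $B$ replaced by $\$B$. Except for second components merged by $\sqcup$, the domains of sets of assignments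 from distinct premises must be disjoint. Rules: (A) $\Gamma,x:L;\Delta;\mathcal{E}\vdash x:L$. (C) from $\Gamma;\Delta;\mathcal{E},(\Theta_x;\{x:A\}),(\Theta_y;\{y:A\})\vdash M:B$ infer $\Gamma;\Delta;\mathcal{E}\sqcup\{(\Theta_x\cup\Theta_y;\{z:A\})\}\vdash M\{z/x,z/y\}:B$. ($\multimap I$) from $\Gamma,x:L;\Delta;\mathcal{E}\vdash M:B$ infer $\Gamma;\Delta;\mathcal{E}\vdash\lambda x.M:L\multimap B$. ($\multimap I_\$$) from $\Gamma;\Delta,x:A;\mathcal{E}\vdash M:B$ infer $\Gamma;\Delta;\mathcal{E}\vdash\lambda x.M:\$A\multimap B$. ($\multimap E$) from $\Gamma_M;\Delta_M;\mathcal{E}_M\vdash M:A\multimap B$ and $\Gamma_N;\Delta_N;\mathcal{E}_N\vdash N:A$, $A$ not of the form $!C$, infer $\Gamma_M,\Gamma_N;\Delta_M,\Delta_N;\mathcal{E}_M\sqcup\mathcal{E}_N\vdash MN:B$. ($\multimap I_!$) from $\Gamma;\Delta;\mathcal{E},(\Theta;\{x:A\})\vdash M:B$ infer $\Gamma;\Delta;\mathcal{E}\sqcup\{(\Theta;\emptyset)\}\vdash\lambda x.M:!A\multimap B$. ($\multimap E_!$) from $\Gamma_M;\Delta_M;\mathcal{E}_M\vdash M:!A\multimap B$ and $\Gamma_N;\Delta_N;\mathcal{E}_N\vdash N:!A$, every pair of $\mathcal{E}_M$ of the form $(\emptyset;\Phi)$, infer $\Gamma_M,\Gamma_N;\Delta_M,\Delta_N;\mathcal{E}_M\sqcup\mathcal{E}_N\vdash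 MN:B$. ($\multimap_e I$) from $\Gamma;\Delta;\mathcal{E},(\Theta\cup\{x:A\};\emptyset)\vdash M:B$ infer $\Gamma;\Delta;\mathcal{E}\sqcup\{(\Theta;\emptyset)\}\vdash\lambda x.M:\$A\multimap_e B$. ($\multimap_e E$) from $\Gamma_M;\Delta;\mathcal{E}_M\vdash M:\$A\multimap_e B$ and $\emptyset;\emptyset;\mathcal{E}_N\vdash N:\$A$, $\mathcal{E}_N\subseteq\{(\Theta;\emptyset)\}$, infer $\Gamma_M;\Delta;\mathcal{E}_M\sqcup\mathcal{E}_N\vdash MN:B$. ($\$$) from $\Gamma;\Delta';\{(\Theta';\emptyset)\}\vdash M:B$ infer $\Gamma';\$\Delta',\Delta;\{(\$\Theta';\emptyset)\}\sqcup\{(\Theta_1;\Phi_1)\}\sqcup\dots\sqcup\{(\Theta_m;\Phi_m)\}\vdash M:\$B$ (any $\Gamma',\Delta$), provided $\Gamma\subseteq\Delta\cup\bigcup_i\Theta_i\cup\bigcup_i\Phi_i$ and $\Theta_i\neq\emptyset$ iff $\Phi_i=\emptyset$. ($!$) from $\Gamma;\emptyset;\{(\Theta';\emptyset)\}\vdash M:B$ infer $\Gamma';\Delta;\{(\$\Theta';\emptyset)\}\sqcup\{(\Theta;\Phi)\}\vdash M:!B$ (any $\Gamma',\Delta$), provided $\Gamma\subseteq\Theta\cup\Phi$ and ($\Theta\neq\emptyset\Rightarrow\mathrm{dom}(\Phi)\cap FV(M)\neq\emptyset$). ($\forall I$) from $M:L$ infer $M:\forall\alpha.L$, $\alpha$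 not free in the contexts. ($\forall E$) from $M:\forall\alpha.L$ infer $M:L\{L'/\alpha\}$, $L'$ linear. Measures, by induction on the last rule $R$ of $\Pi$ (premise deductions $\Pi',\Pi''$). Depth $\partial(\Pi)$: $0$ for (A); $\partial(\Pi')+1$ if $R\in\{!,\$\}$; $\partial(\Pi')$ for other one-premise rules; $\max(\partial(\Pi'),\partial(\Pi''))$ for two-premise rules. Partial size $|\Pi|_d$: (A): $|\Pi|_0=1$, $|\Pi|_d=0$ for $d\ge1$; (C): $|\Pi|_0=|\Pi'|_0$, $|\Pi|_d=|\Pi'|_d+1$ for $d\ge1$; ($\forall I$),($\forall E$): $|\Pi|_d=|\Pi'|_d$; introductions ($\multimap I,\multimap I_!,\multimap I_\$,\multimap_e I$): $|\Pi|_0=|\Pi'|_0+1$, $|\Pi|_d=|\Pi'|_d$ for $d\ge1$; eliminations ($\multimap E,\multimap E_!,\multimap_e E$): $|\Pi|_d=|\Pi'|_d+|\Pi''|_d+1$ for all $d\ge0$; ($!$),($\$$): $|\Pi|_0=0$, $|\Pi|_d=|\Pi'|_{d-1}$ for $d\ge1$. Width $w_d(\Pi)$: $w_0(\Pi)=0$; (A): $w_d=0$; (C): $w_1=w_1(\Pi')+1$, $w_d=w_d(\Pi')$ for $d>1$; ($\forall I$),($\forall E$), introductions: $w_d=w_d(\Pi')$ for $d\ge1$; eliminations: $w_1=w_1(\Pi')+w_1(\Pi'')+1$, $w_d=w_d(\Pi')+w_d(\Pi'')$ for $d>1$; ($!$),($\$$): $w_d=w_{d-1}(\Pi')$ for $d\ge1$.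 Partial size and width at depths outside $0,\dots,\partial(\Pi)$ are $0$. Term size: $|x|=1$, $|\lambda x.M|=|M|+1$, $|MN|=|M|+|N|+1$. -}

module Defs where

open import Data.Nat using (ℕ; zero; suc; _+_; _⊔_; _<ᵇ_; _≡ᵇ_; _≤ᵇ_; pred)
open import Data.Bool using (Bool; true; false; if_then_else_)
open import Data.Product using (Σ; _×_; _,_; proj₁; proj₂)
open import Data.Sum using (_⊎_)
open import Data.Maybe using (Maybe; just; nothing)
open import Data.List using (List; []; _∷_; _++_; map)
open import Data.List.Relation.Unary.Any using (Any)
open import Data.List.Relation.Unary.All using (All)
open import Data.List.Membership.Propositional using (_∈_)
open import Relation.Binary.PropositionalEquality using (_≡_)
open import Relation.Nullary using (¬_)
open import Data.Empty using (⊥)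
open import Data.Unit using (⊤)

-- Formulas (de Bruijn indices for type variables, so formulas are
-- identified up to alpha-equivalence).
--   A ::= L | !A | $A        L ::= α | A ⊸ A | $A ⊸ₑ A | ∀α.L

infixr 30 !_ §_
infixr 20 _⊸_ _⊸ₑ_

mutual
  data Form : Set where
    lin : Lin → Form
    !_  : Form → Form
    §_  : Form → Form         -- §A stands for $A

  data Lin : Set where
    atom : ℕ → Lin
    _⊸_  : Form → Form → Lin
    _⊸ₑ_ : Form → Form → Lin  -- A ⊸ₑ B stands for $A ⊸_e B
    allL : Lin → Lin          -- ∀α.L, α bound as index 0

mutual
  shiftF : ℕ → Form → Form
  shiftF c (lin L) = lin (shiftL c L)
  shiftF c (! A) = ! shiftF c A
  shiftF c (§ A) = § shiftF c A

  shiftL : ℕ → Lin → Lin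
  shiftL c (atom n) = if n <ᵇ c then atom n else atom (suc n)
  shiftL c (A ⊸ B) = shiftF c A ⊸ shiftF c B
  shiftL c (A ⊸ₑ B) = shiftF c A ⊸ₑ shiftF c B
  shiftL c (allL L) = allL (shiftL (suc c) L)

mutual
  substF : ℕ → Lin → Form → Form
  substF k L' (lin L) = lin (substL k L' L)
  substF k L' (! A) = ! substF k L' A
  substF k L' (§ A) = § substF k L' A

  substL : ℕ → Lin → Lin → Lin
  substL k L' (atom n) =
    if n <ᵇ k then atom n else (if n ≡ᵇ k then L' else atom (pred n))
  substL k L' (A ⊸ B) = substF k L' A ⊸ substF k L' B
  substL k L' (A ⊸ₑ B) = substF k L' A ⊸ₑ substF k L' B
  substL k L' (allL L) = allL (substL (suc k) (shiftL 0 L') L)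

_[_/0] : Lin → Lin → Lin
L [ L' /0] = substL 0 L' L

NotBang : Form → Set
NotBang (! _) = ⊥
NotBang _ = ⊤

data Term : Set where
  var : ℕ → Term
  lam : ℕ → Term → Term
  app : Term → Term → Term

tsize : Term → ℕ
tsize (var _) = 1
tsize (lam _ M) = suc (tsize M)
tsize (app M N) = tsize M + tsize N + 1

data _∈FV_ : ℕ → Term → Set where
  fv-var  : ∀ {x} → x ∈FV var x
  fv-lam  : ∀ {x y M} → ¬ (x ≡ y) → x ∈FV M → x ∈FV lam y M
  fv-appˡ : ∀ {x M N} → x ∈FV M → x ∈FV app M N
  fv-appʳ : ∀ {x M N} → x ∈FV N → x ∈FV app M N

upd : (ℕ → ℕ) → ℕ → ℕ → (ℕ → ℕ)
upd σ v w u = if u ≡ᵇ v then w else σ u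

-- Ren σ M M' : M' is (an alpha-variant of) the capture-avoiding
-- simultaneous renaming of the free variables of M according to σ.
data Ren : (ℕ → ℕ) → Term → Term → Set where
  ren-var : ∀ {σ x} → Ren σ (var x) (var (σ x))
  ren-app : ∀ {σ M N M' N'} → Ren σ M M' → Ren σ N N' → Ren σ (app M N) (app M' N')
  ren-lam : ∀ {σ v w M M'} →
            (∀ u → u ∈FV lam v M → ¬ (σ u ≡ w)) →
            Ren (upd σ v w) M M' → Ren σ (lam v M) (lam w M')

ren2 : ℕ → ℕ → ℕ → ℕ → ℕ
ren2 x y z u = if u ≡ᵇ x then z else (if u ≡ᵇ y then z else u)

-- Contexts: finite sets of type assignments, represented by lists and
-- always compared up to set equality.

_↔′_ : Set → Set → Set
P ↔′ Q = (P → Q) × (Q → P)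

Assn : Set
Assn = ℕ × Form

Ctx : Set
Ctx = List Assn

-- a pair (Θ ; Φ), Φ = nothing is ∅, Φ = just (x , A) is {x:A}
Pair : Set
Pair = Ctx × Maybe Assn

ECtx : Set
ECtx = List Pair

_≋_ : Ctx → Ctx → Set
Γ ≋ Γ' = ∀ a → (a ∈ Γ) ↔′ (a ∈ Γ')

_∈dom_ : ℕ → Ctx → Set
x ∈dom Γ = Any (λ a → proj₁ a ≡ x) Γ

Disjoint : Ctx → Ctx → Set
Disjoint Γ Γ' = ∀ x → x ∈dom Γ → x ∈dom Γ' → ⊥

PairEq : Pair → Pair → Set
PairEq p q = (proj₁ p ≋ proj₁ q) × (proj₂ p ≡ proj₂ q)

_∈E_ : Pair → ECtx → Set
p ∈E E = Any (PairEq p) E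

_≋E_ : ECtx → ECtx → Set
E ≋E E' = ∀ p → (p ∈E E) ↔′ (p ∈E E')

HasSnd : ECtx → Maybe Assn → Set
HasSnd E Φ = Any (λ p → proj₂ p ≡ Φ) E

-- well-formedness of 𝓔: at most one pair with Φ = ∅, and the variables
-- of distinct Φ's are distinct
WFE : ECtx → Set
WFE E =
  (∀ p q → p ∈ E → q ∈ E → proj₂ p ≡ nothing → proj₂ q ≡ nothing → proj₁ p ≋ proj₁ q)
  × (∀ p q x A B → p ∈ E → q ∈ E → proj₂ p ≡ just (x , A) → proj₂ q ≡ just (x , B) → A ≡ B)

IsUnit : ECtx → Set
IsUnit E = E ≋E (([] , nothing) ∷ [])

-- membership in the generic 𝓔₁ ⊔ 𝓔₂
InGen : ECtx → ECtx → Pair → Set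
InGen E₁ E₂ p =
  (Σ Ctx λ Θ₁ → Σ Ctx λ Θ₂ →
     ((Θ₁ , proj₂ p) ∈E E₁) × ((Θ₂ , proj₂ p) ∈E E₂) × (proj₁ p ≋ (Θ₁ ++ Θ₂)))
  ⊎ ((p ∈E E₁) × ¬ HasSnd E₂ (proj₂ p))
  ⊎ ((p ∈E E₂) × ¬ HasSnd E₁ (proj₂ p))

-- Join E₁ E₂ E  :  E = E₁ ⊔ E₂  (with E ⊔ {(∅;∅)} = {(∅;∅)} ⊔ E = E)
Join : ECtx → ECtx → ECtx → Set
Join E₁ E₂ E =
  (IsUnit E₂ × E ≋E E₁)
  ⊎ (IsUnit E₁ × E ≋E E₂)
  ⊎ (¬ IsUnit E₁ × ¬ IsUnit E₂ × (∀ p → (p ∈E E) ↔′ InGen E₁ E₂ p))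

JoinL : ECtx → List Pair → ECtx → Set
JoinL E₀ [] E = E ≋E E₀
JoinL E₀ (p ∷ ps) E = Σ ECtx λ E₁ → Join E₀ (p ∷ []) E₁ × JoinL E₁ ps E

§Ctx : Ctx → Ctx
§Ctx = map (λ a → proj₁ a , § proj₂ a)

shiftCtx : Ctx → Ctx
shiftCtx = map (λ a → proj₁ a , shiftF 0 (proj₂ a))

shiftE : ECtx → ECtx
shiftE = map (λ p → shiftCtx (proj₁ p) , shiftΦ (proj₂ p))
  where
  shiftΦ : Maybe Assn → Maybe Assn
  shiftΦ nothing = nothing
  shiftΦ (just (x , A)) = just (x , shiftF 0 A)

PlainVar : ℕ → Ctx → Ctx → ECtx → Set
PlainVar x Γ Δ E = x ∈dom Γ ⊎ x ∈dom Δ ⊎ Any (λ p → x ∈dom proj₁ p) E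

PhiVar : ℕ → ECtx → Set
PhiVar x E = Any (λ p → Σ Form λ A → proj₂ p ≡ just (x , A)) E

-- domains of the two premises are disjoint, except for second
-- components {x:A} merged by ⊔
PremDisj : Ctx → Ctx → ECtx → Ctx → Ctx → ECtx → Set
PremDisj Γ₁ Δ₁ E₁ Γ₂ Δ₂ E₂ =
  ∀ x → (PlainVar x Γ₁ Δ₁ E₁ ⊎ PhiVar x E₁) → (PlainVar x Γ₂ Δ₂ E₂ ⊎ PhiVar x E₂) →
    ¬ PlainVar x Γ₁ Δ₁ E₁ × ¬ PlainVar x Γ₂ Δ₂ E₂
    × (Σ Form λ A → HasSnd E₁ (just (x , A)) × HasSnd E₂ (just (x , A)))

-- WALT deductions  Γ ; Δ ; 𝓔 ⊢ M : A

data Deriv : Ctx → Ctx → ECtx → Term → Form → Set where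
  ax : ∀ {Γ Γ₀ Δ E x L} →
       Γ ≋ ((x , lin L) ∷ Γ₀) → ¬ (x ∈dom Γ₀) → WFE E →
       Deriv Γ Δ E (var x) (lin L)
  contr : ∀ {Γ Δ E₁ E₀ E Θx Θy x y z A B M M'} →
       Deriv Γ Δ E₁ M B →
       E₁ ≋E ((Θx , just (x , A)) ∷ (Θy , just (y , A)) ∷ E₀) →
       ¬ ((Θx , just (x , A)) ∈E E₀) →
       ¬ ((Θy , just (y , A)) ∈E ((Θx , just (x , A)) ∷ E₀)) →
       Join E₀ (((Θx ++ Θy) , just (z , A)) ∷ []) E →
       Ren (ren2 x y z) M M' → WFE E →
       Deriv Γ Δ E M' B
  ⊸I : ∀ {Γ Γ₁ Δ E x L M B} →
       Deriv Γ₁ Δ E M B →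
       Γ₁ ≋ ((x , lin L) ∷ Γ) → ¬ (x ∈dom Γ) → WFE E →
       Deriv Γ Δ E (lam x M) (lin (lin L ⊸ B))
  ⊸I§ : ∀ {Γ Δ Δ₁ E x A M B} →
       Deriv Γ Δ₁ E M B →
       Δ₁ ≋ ((x , A) ∷ Δ) → ¬ (x ∈dom Δ) → WFE E →
       Deriv Γ Δ E (lam x M) (lin (§ A ⊸ B))
  ⊸E : ∀ {ΓM ΔM EM ΓN ΔN EN Γ Δ E M N A B} →
       Deriv ΓM ΔM EM M (lin (A ⊸ B)) → Deriv ΓN ΔN EN N A →
       NotBang A → PremDisj ΓM ΔM EM ΓN ΔN EN →
       Γ ≋ (ΓM ++ ΓN) → Δ ≋ (ΔM ++ ΔN) → Join EM EN E → WFE E →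
       Deriv Γ Δ E (app M N) B
  ⊸I! : ∀ {Γ Δ E₁ E₀ E Θ x A M B} →
       Deriv Γ Δ E₁ M B →
       E₁ ≋E ((Θ , just (x , A)) ∷ E₀) → ¬ ((Θ , just (x , A)) ∈E E₀) →
       Join E₀ ((Θ , nothing) ∷ []) E → WFE E →
       Deriv Γ Δ E (lam x M) (lin (! A ⊸ B))
  ⊸E! : ∀ {ΓM ΔM EM ΓN ΔN EN Γ Δ E M N A B} →
       Deriv ΓM ΔM EM M (lin (! A ⊸ B)) → Deriv ΓN ΔN EN N (! A) →
       All (λ p → proj₁ p ≡ []) EM → PremDisj ΓM ΔM EM ΓN ΔN EN →
       Γ ≋ (ΓM ++ ΓN) → Δ ≋ (ΔM ++ ΔN) → Join EM EN E → WFE E →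
       Deriv Γ Δ E (app M N) B
  ⊸ₑI : ∀ {Γ Δ E₁ E₀ E Θ x A M B} →
       Deriv Γ Δ E₁ M B →
       E₁ ≋E ((((x , A) ∷ Θ) , nothing) ∷ E₀) → ¬ ((((x , A) ∷ Θ) , nothing) ∈E E₀) →
       Join E₀ ((Θ , nothing) ∷ []) E → WFE E →
       Deriv Γ Δ E (lam x M) (lin (A ⊸ₑ B))
  ⊸ₑE : ∀ {ΓM Δ EM EN E M N A B} →
       Deriv ΓM Δ EM M (lin (A ⊸ₑ B)) → Deriv [] [] EN N (§ A) →
       (Σ Ctx λ Θ → All (λ p → PairEq p (Θ , nothing)) EN) →
       PremDisj ΓM Δ EM [] [] EN →
       Join EM EN E → WFE E →
       Deriv ΓM Δ E (app M N) B
  §R : ∀ {Γ Δ' E' Θ' M B Γ' Δ Δc ps Ec} →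
       Deriv Γ Δ' E' M B →
       E' ≋E ((Θ' , nothing) ∷ []) →
       Δc ≋ (§Ctx Δ' ++ Δ) → Disjoint (§Ctx Δ') Δ →
       JoinL ((§Ctx Θ' , nothing) ∷ []) ps Ec →
       (∀ a → a ∈ Γ → a ∈ Δ ⊎ Any (λ p → a ∈ proj₁ p ⊎ proj₂ p ≡ just a) ps) →
       All (λ p → (¬ (proj₁ p ≡ []) → proj₂ p ≡ nothing) × (proj₂ p ≡ nothing → ¬ (proj₁ p ≡ []))) ps →
       WFE Ec →
       Deriv Γ' Δc Ec M (§ B)
  !R : ∀ {Γ E' Θ' M B Γ' Δ Θ Φ Ec} →
       Deriv Γ [] E' M B →
       E' ≋E ((Θ' , nothing) ∷ []) →
       Join ((§Ctx Θ' , nothing) ∷ []) ((Θ , Φ) ∷ []) Ec →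
       (∀ a → a ∈ Γ → a ∈ Θ ⊎ Φ ≡ just a) →
       (¬ (Θ ≡ []) → Σ ℕ λ x → Σ Form λ A → (Φ ≡ just (x , A)) × x ∈FV M) →
       WFE Ec →
       Deriv Γ' Δ Ec M (! B)
  -- (∀I): the premise lives under the new binder; its contexts are the
  -- shifted conclusion contexts, i.e. α is not free in them
  ∀I : ∀ {Γ Δ E M L} →
       Deriv (shiftCtx Γ) (shiftCtx Δ) (shiftE E) M (lin L) → WFE E →
       Deriv Γ Δ E M (lin (allL L))
  ∀E : ∀ {Γ Δ E M L} (L' : Lin) →
       Deriv Γ Δ E M (lin (allL L)) → WFE E →
       Deriv Γ Δ E M (lin (L [ L' /0]))

depth : ∀ {Γ Δ E M A} → Deriv Γ Δ E M A → ℕ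
depth (ax _ _ _) = 0
depth (contr Π _ _ _ _ _ _) = depth Π
depth (⊸I Π _ _ _) = depth Π
depth (⊸I§ Π _ _ _) = depth Π
depth (⊸E Π Π' _ _ _ _ _ _) = depth Π ⊔ depth Π'
depth (⊸I! Π _ _ _ _) = depth Π
depth (⊸E! Π Π' _ _ _ _ _ _) = depth Π ⊔ depth Π'
depth (⊸ₑI Π _ _ _ _) = depth Π
depth (⊸ₑE Π Π' _ _ _ _) = depth Π ⊔ depth Π'
depth (§R Π _ _ _ _ _ _ _) = suc (depth Π)
depth (!R Π _ _ _ _ _) = suc (depth Π)
depth (∀I Π _) = depth Π
depth (∀E _ Π _) = depth Π

-- cut D d v = v if d ≤ D, else 0  (measures vanish outside 0..∂(Π))
cut : ℕ → ℕ → ℕ → ℕ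
cut D d v = if d ≤ᵇ D then v else 0

psize : ∀ {Γ Δ E M A} → Deriv Γ Δ E M A → ℕ → ℕ
psize (ax _ _ _) zero = 1
psize (ax _ _ _) (suc d) = 0
psize (contr Π _ _ _ _ _ _) zero = psize Π 0
psize (contr Π _ _ _ _ _ _) (suc d) = cut (depth Π) (suc d) (psize Π (suc d) + 1)
psize (⊸I Π _ _ _) zero = psize Π 0 + 1
psize (⊸I Π _ _ _) (suc d) = psize Π (suc d)
psize (⊸I§ Π _ _ _) zero = psize Π 0 + 1
psize (⊸I§ Π _ _ _) (suc d) = psize Π (suc d)
psize (⊸E Π Π' _ _ _ _ _ _) d = cut (depth Π ⊔ depth Π') d (psize Π d + psize Π' d + 1)
psize (⊸I! Π _ _ _ _) zero = psize Π 0 + 1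
psize (⊸I! Π _ _ _ _) (suc d) = psize Π (suc d)
psize (⊸E! Π Π' _ _ _ _ _ _) d = cut (depth Π ⊔ depth Π') d (psize Π d + psize Π' d + 1)
psize (⊸ₑI Π _ _ _ _) zero = psize Π 0 + 1
psize (⊸ₑI Π _ _ _ _) (suc d) = psize Π (suc d)
psize (⊸ₑE Π Π' _ _ _ _) d = cut (depth Π ⊔ depth Π') d (psize Π d + psize Π' d + 1)
psize (§R Π _ _ _ _ _ _ _) zero = 0
psize (§R Π _ _ _ _ _ _ _) (suc d) = psize Π d
psize (!R Π _ _ _ _ _) zero = 0
psize (!R Π _ _ _ _ _) (suc d) = psize Π d
psize (∀I Π _) d = psize Π d
psize (∀E _ Π _) d = psize Π d

width : ∀ {Γ Δ E M A} → Deriv Γ Δ E M A → ℕ → ℕ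
width _ zero = 0
width (ax _ _ _) (suc d) = 0
width (contr Π _ _ _ _ _ _) (suc zero) = cut (depth Π) 1 (width Π 1 + 1)
width (contr Π _ _ _ _ _ _) (suc (suc d)) = width Π (suc (suc d))
width (⊸I Π _ _ _) (suc d) = width Π (suc d)
width (⊸I§ Π _ _ _) (suc d) = width Π (suc d)
width (⊸E Π Π' _ _ _ _ _ _) (suc zero) = cut (depth Π ⊔ depth Π') 1 (width Π 1 + width Π' 1 + 1)
width (⊸E Π Π' _ _ _ _ _ _) (suc (suc d)) = width Π (suc (suc d)) + width Π' (suc (suc d))
width (⊸I! Π _ _ _ _) (suc d) = width Π (suc d)
width (⊸E! Π Π' _ _ _ _ _ _) (suc zero) = cut (depth Π ⊔ depth Π') 1 (width Π 1 + width Π' 1 + 1)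
width (⊸E! Π Π' _ _ _ _ _ _) (suc (suc d)) = width Π (suc (suc d)) + width Π' (suc (suc d))
width (⊸ₑI Π _ _ _ _) (suc d) = width Π (suc d)
width (⊸ₑE Π Π' _ _ _ _) (suc zero) = cut (depth Π ⊔ depth Π') 1 (width Π 1 + width Π' 1 + 1)
width (⊸ₑE Π Π' _ _ _ _) (suc (suc d)) = width Π (suc (suc d)) + width Π' (suc (suc d))
width (§R Π _ _ _ _ _ _ _) (suc d) = width Π d
width (!R Π _ _ _ _ _) (suc d) = width Π d
width (∀I Π _) (suc d) = width Π (suc d)
width (∀E _ Π _) (suc d) = width Π (suc d)

sumTo : ℕ → (ℕ → ℕ) → ℕ
sumTo zero f = f 0
sumTo (suc D) f = sumTo D f + f (suc D)

module Submission where

--  (1) We prove w_d(Π) ≤ |Π|_d for EVERY d.  In the clauses for (C) and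
--      for eliminations the right-hand side is truncated at ∂(Π), so we
--      first show that the width itself vanishes above the depth.
--  (2) For |M| ≤ Σ_{d ≤ ∂(Π)} |Π|_d we use elementary facts about the
--      finite sums `sumTo`: each rule adds at least as much to the
--      right-hand side as it adds to the term (an introduction adds 1 at
--      depth 0, an elimination adds the two sums plus 1, (!) and ($)
--      shift the sum up by one level, contraction only renames the term).

open import Defs
open import Data.Nat using (ℕ; zero; suc; _+_; _⊔_; _≤_; _<_; _≤ᵇ_; _≤?_; z≤n; s≤s)
open import Data.Nat.Properties
open import Data.Nat.Solver using (module +-*-Solver)
open import Data.Bool using (true; false)
open import Data.Product using (_×_; _,_)
open import Data.Sum using (inj₁; inj₂)
open import Relation.Nullary using (yes; no; contradiction)
open import Relation.Nullary.Reflects using (ofʸ; ofⁿ)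
open import Relation.Binary.PropositionalEquality using (_≡_; refl; sym; trans; cong; cong₂)

cut-inside : ∀ {D d} v → d ≤ D → cut D d v ≡ v
cut-inside {D} {d} v d≤D with d ≤ᵇ D | ≤ᵇ-reflects-≤ d D
... | true  | _       = refl
... | false | ofⁿ d≰D = contradiction d≤D d≰D

cut-outside : ∀ {D d} v → D < d → cut D d v ≡ 0
cut-outside {D} {d} v D<d with d ≤ᵇ D | ≤ᵇ-reflects-≤ d D
... | false | _       = refl
... | true  | ofʸ d≤D = contradiction d≤D (<⇒≱ D<d)

cut-mono : ∀ D d {a b} → (d ≤ D → a ≤ b) → cut D d a ≤ cut D d b
cut-mono D d {a} {b} a≤b with d ≤? D
... | yes d≤D rewrite cut-inside a d≤D | cut-inside b d≤D = a≤b d≤D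
... | no d≰D  rewrite cut-outside a (≰⇒> d≰D)                = z≤n

≤-cut : ∀ D d {a b} → (d ≤ D → a ≤ b) → (D < d → a ≡ 0) → a ≤ cut D d b
≤-cut D d {a} {b} a≤b a≡0 with d ≤? D
... | yes d≤D rewrite cut-inside b d≤D = a≤b d≤D
... | no d≰D  rewrite a≡0 (≰⇒> d≰D)    = z≤n

sumTo-mono : ∀ D {f g : ℕ → ℕ} → (∀ d → d ≤ D → f d ≤ g d) → sumTo D f ≤ sumTo D g
sumTo-mono zero    f≤g = f≤g 0 z≤n
sumTo-mono (suc D) f≤g =
  +-mono-≤ (sumTo-mono D (λ d d≤D → f≤g d (m≤n⇒m≤1+n d≤D))) (f≤g (suc D) ≤-refl)

sumTo-monoʳ : ∀ (f : ℕ → ℕ) {D D'} → D ≤ D' → sumTo D f ≤ sumTo D' f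
sumTo-monoʳ f {D} {zero}   z≤n = ≤-refl
sumTo-monoʳ f {D} {suc D'} D≤1+D' with m≤n⇒m<n∨m≡n D≤1+D'
... | inj₁ (s≤s D≤D') = ≤-trans (sumTo-monoʳ f D≤D') (m≤m+n _ _)
... | inj₂ refl       = ≤-refl

sumTo-unconsˡ : ∀ D (f : ℕ → ℕ) → sumTo (suc D) f ≡ f 0 + sumTo D (λ d → f (suc d))
sumTo-unconsˡ zero    f = refl
sumTo-unconsˡ (suc D) f =
  trans (cong (_+ f (suc (suc D))) (sumTo-unconsˡ D f)) (+-assoc (f 0) _ _)

sumTo-shift-≤ : ∀ D (f : ℕ → ℕ) → sumTo D (λ d → f (suc d)) ≤ sumTo (suc D) f
sumTo-shift-≤ D f rewrite sumTo-unconsˡ D f = m≤n+m _ (f 0)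

sumTo-bump₀ : ∀ D (f g : ℕ → ℕ) → f 0 ≡ g 0 + 1 → (∀ d → f (suc d) ≡ g (suc d)) →
              sumTo D f ≡ suc (sumTo D g)
sumTo-bump₀ zero    f g f₀ _  = trans f₀ (+-comm _ 1)
sumTo-bump₀ (suc D) f g f₀ fₛ = cong₂ _+_ (sumTo-bump₀ D f g f₀ fₛ) (fₛ D)

sumTo-superadditive : ∀ D (f g : ℕ → ℕ) →
                      sumTo D f + sumTo D g + 1 ≤ sumTo D (λ d → f d + g d + 1)
sumTo-superadditive zero    f g = ≤-refl
sumTo-superadditive (suc D) f g =
  ≤-trans (≤-reflexive (regroup (sumTo D f) (f (suc D)) (sumTo D g) (g (suc D))))
          (+-mono-≤ (sumTo-superadditive D f g) (m≤m+n _ 1))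
  where
  open +-*-Solver
  regroup : ∀ a b c e → (a + b) + (c + e) + 1 ≡ (a + c + 1) + (b + e)
  regroup = solve 4 (λ a b c e → (a :+ b) :+ (c :+ e) :+ con 1 := (a :+ c :+ con 1) :+ (b :+ e)) refl

ren-tsize : ∀ {σ M M'} → Ren σ M M' → tsize M' ≡ tsize M
ren-tsize ren-var = refl
ren-tsize (ren-app r r') = cong₂ (λ a b → a + b + 1) (ren-tsize r) (ren-tsize r')
ren-tsize (ren-lam _ r) = cong suc (ren-tsize r)

width-vanishes : ∀ {Γ Δ E M A} (Π : Deriv Γ Δ E M A) d → depth Π < d → width Π d ≡ 0

widths-vanish : ∀ {Γ Δ E M A Γ' Δ' E' M' A'}
                (Π : Deriv Γ Δ E M A) (Π' : Deriv Γ' Δ' E' M' A') d →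
                depth Π ⊔ depth Π' < d → width Π d + width Π' d ≡ 0
widths-vanish Π Π' d D<d =
  cong₂ _+_ (width-vanishes Π d (m⊔n<o⇒m<o _ _ D<d))
            (width-vanishes Π' d (m⊔n<o⇒n<o _ _ D<d))

width-vanishes (ax _ _ _) (suc d) _ = refl
width-vanishes (contr _ _ _ _ _ _ _) (suc zero) D<1 = cut-outside _ D<1
width-vanishes (contr Π _ _ _ _ _ _) (suc (suc d)) D<d = width-vanishes Π _ D<d
width-vanishes (⊸I Π _ _ _) (suc d) D<d = width-vanishes Π _ D<d
width-vanishes (⊸I§ Π _ _ _) (suc d) D<d = width-vanishes Π _ D<d
width-vanishes (⊸I! Π _ _ _ _) (suc d) D<d = width-vanishes Π _ D<d
width-vanishes (⊸ₑI Π _ _ _ _) (suc d) D<d = width-vanishes Π _ D<d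
width-vanishes (⊸E _ _ _ _ _ _ _ _) (suc zero) D<1 = cut-outside _ D<1
width-vanishes (⊸E Π Π' _ _ _ _ _ _) (suc (suc d)) D<d = widths-vanish Π Π' _ D<d
width-vanishes (⊸E! _ _ _ _ _ _ _ _) (suc zero) D<1 = cut-outside _ D<1
width-vanishes (⊸E! Π Π' _ _ _ _ _ _) (suc (suc d)) D<d = widths-vanish Π Π' _ D<d
width-vanishes (⊸ₑE _ _ _ _ _ _) (suc zero) D<1 = cut-outside _ D<1
width-vanishes (⊸ₑE Π Π' _ _ _ _) (suc (suc d)) D<d = widths-vanish Π Π' _ D<d
width-vanishes (§R Π _ _ _ _ _ _ _) (suc d) (s≤s D<d) = width-vanishes Π d D<d
width-vanishes (!R Π _ _ _ _ _) (suc d) (s≤s D<d) = width-vanishes Π d D<d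
width-vanishes (∀I Π _) (suc d) D<d = width-vanishes Π _ D<d
width-vanishes (∀E _ Π _) (suc d) D<d = width-vanishes Π _ D<d

elim-width-shallow : ∀ D {w₁ w₂ p₁ p₂} → w₁ ≤ p₁ → w₂ ≤ p₂ →
                     cut D 1 (w₁ + w₂ + 1) ≤ cut D 1 (p₁ + p₂ + 1)
elim-width-shallow D w₁≤p₁ w₂≤p₂ = cut-mono D 1 (λ _ → +-monoˡ-≤ 1 (+-mono-≤ w₁≤p₁ w₂≤p₂))

-- The same at depth d > 1, where the width clause is not truncated and
-- we use that it vanishes above the depth.
elim-width-deep : ∀ D d {w₁ w₂ p₁ p₂} → w₁ ≤ p₁ → w₂ ≤ p₂ → (D < d → w₁ + w₂ ≡ 0) →
                  w₁ + w₂ ≤ cut D d (p₁ + p₂ + 1)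
elim-width-deep D d w₁≤p₁ w₂≤p₂ vanish =
  ≤-cut D d (λ _ → ≤-trans (+-mono-≤ w₁≤p₁ w₂≤p₂) (m≤m+n _ 1)) vanish

-- Part (1) at every depth d (outside 0..∂(Π) both sides are 0 anyway).
width≤psize : ∀ {Γ Δ E M A} (Π : Deriv Γ Δ E M A) d → width Π d ≤ psize Π d
width≤psize Π zero = z≤n
width≤psize (ax _ _ _)             (suc d)       = z≤n
width≤psize (contr Π _ _ _ _ _ _)  (suc zero)    =
  cut-mono (depth Π) 1 (λ _ → +-monoˡ-≤ 1 (width≤psize Π 1))
width≤psize (contr Π _ _ _ _ _ _)  (suc (suc d)) =
  ≤-cut (depth Π) (suc (suc d)) (λ _ → ≤-trans (width≤psize Π _) (m≤m+n _ 1))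
        (width-vanishes Π _)
width≤psize (⊸I Π _ _ _)           (suc d)       = width≤psize Π _
width≤psize (⊸I§ Π _ _ _)          (suc d)       = width≤psize Π _
width≤psize (⊸I! Π _ _ _ _)        (suc d)       = width≤psize Π _
width≤psize (⊸ₑI Π _ _ _ _)        (suc d)       = width≤psize Π _
width≤psize (⊸E Π Π' _ _ _ _ _ _)  (suc zero)    =
  elim-width-shallow (depth Π ⊔ depth Π') (width≤psize Π 1) (width≤psize Π' 1)
width≤psize (⊸E Π Π' _ _ _ _ _ _)  (suc (suc d)) =
  elim-width-deep (depth Π ⊔ depth Π') _ (width≤psize Π _) (width≤psize Π' _) (widths-vanish Π Π' _)
width≤psize (⊸E! Π Π' _ _ _ _ _ _) (suc zero)    =
  elim-width-shallow (depth Π ⊔ depth Π') (width≤psize Π 1) (width≤psize Π' 1)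
width≤psize (⊸E! Π Π' _ _ _ _ _ _) (suc (suc d)) =
  elim-width-deep (depth Π ⊔ depth Π') _ (width≤psize Π _) (width≤psize Π' _) (widths-vanish Π Π' _)
width≤psize (⊸ₑE Π Π' _ _ _ _)     (suc zero)    =
  elim-width-shallow (depth Π ⊔ depth Π') (width≤psize Π 1) (width≤psize Π' 1)
width≤psize (⊸ₑE Π Π' _ _ _ _)     (suc (suc d)) =
  elim-width-deep (depth Π ⊔ depth Π') _ (width≤psize Π _) (width≤psize Π' _) (widths-vanish Π Π' _)
width≤psize (§R Π _ _ _ _ _ _ _)   (suc d)       = width≤psize Π d
width≤psize (!R Π _ _ _ _ _)       (suc d)       = width≤psize Π d
width≤psize (∀I Π _)               (suc d)       = width≤psize Π _
width≤psize (∀E _ Π _)             (suc d)       = width≤psize Π _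

-- A one-premise rule adding 1 to the partial size at depth 0 only
-- (the introductions) dominates the one symbol λx it adds to the term.
intro-size : ∀ D (f g : ℕ → ℕ) {n} → n ≤ sumTo D g →
             f 0 ≡ g 0 + 1 → (∀ d → f (suc d) ≡ g (suc d)) → suc n ≤ sumTo D f
intro-size D f g n≤Σg f₀ fₛ = ≤-trans (s≤s n≤Σg) (≤-reflexive (sym (sumTo-bump₀ D f g f₀ fₛ)))

-- A two-premise rule (the eliminations) adds the partial sizes of its
-- premises plus 1 at every depth up to the maximal one; this dominates
-- the sizes of the two subterms plus the application node.
elim-size : ∀ D₁ D₂ (f g : ℕ → ℕ) {a b} → a ≤ sumTo D₁ f → b ≤ sumTo D₂ g →
            a + b + 1 ≤ sumTo (D₁ ⊔ D₂) (λ d → cut (D₁ ⊔ D₂) d (f d + g d + 1))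
elim-size D₁ D₂ f g a≤Σf b≤Σg =
  ≤-trans (+-monoˡ-≤ 1 (+-mono-≤ (≤-trans a≤Σf (sumTo-monoʳ f (m≤m⊔n D₁ D₂)))
                                  (≤-trans b≤Σg (sumTo-monoʳ g (m≤n⊔m D₁ D₂)))))
  (≤-trans (sumTo-superadditive D f g)
           (sumTo-mono D (λ d d≤D → ≤-reflexive (sym (cut-inside _ d≤D)))))
  where D = D₁ ⊔ D₂

tsize≤Σpsize : ∀ {Γ Δ E M A} (Π : Deriv Γ Δ E M A) → tsize M ≤ sumTo (depth Π) (psize Π)
tsize≤Σpsize (ax _ _ _) = ≤-refl
tsize≤Σpsize Π₀@(contr Π _ _ _ _ r _) =
  ≤-trans (≤-reflexive (ren-tsize r)) (≤-trans (tsize≤Σpsize Π) (sumTo-mono (depth Π) psize-grows))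
  where
  psize-grows : ∀ d → d ≤ depth Π → psize Π d ≤ psize Π₀ d
  psize-grows zero    _   = ≤-refl
  psize-grows (suc d) d≤D = ≤-trans (m≤m+n _ 1) (≤-reflexive (sym (cut-inside _ d≤D)))
tsize≤Σpsize Π₀@(⊸I Π _ _ _)    = intro-size (depth Π) (psize Π₀) (psize Π) (tsize≤Σpsize Π) refl (λ _ → refl)
tsize≤Σpsize Π₀@(⊸I§ Π _ _ _)   = intro-size (depth Π) (psize Π₀) (psize Π) (tsize≤Σpsize Π) refl (λ _ → refl)
tsize≤Σpsize Π₀@(⊸I! Π _ _ _ _) = intro-size (depth Π) (psize Π₀) (psize Π) (tsize≤Σpsize Π) refl (λ _ → refl)
tsize≤Σpsize Π₀@(⊸ₑI Π _ _ _ _) = intro-size (depth Π) (psize Π₀) (psize Π) (tsize≤Σpsize Π) refl (λ _ → refl)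
tsize≤Σpsize (⊸E Π Π' _ _ _ _ _ _) =
  elim-size (depth Π) (depth Π') (psize Π) (psize Π') (tsize≤Σpsize Π) (tsize≤Σpsize Π')
tsize≤Σpsize (⊸E! Π Π' _ _ _ _ _ _) =
  elim-size (depth Π) (depth Π') (psize Π) (psize Π') (tsize≤Σpsize Π) (tsize≤Σpsize Π')
tsize≤Σpsize (⊸ₑE Π Π' _ _ _ _) =
  elim-size (depth Π) (depth Π') (psize Π) (psize Π') (tsize≤Σpsize Π) (tsize≤Σpsize Π')
tsize≤Σpsize Π₀@(§R Π _ _ _ _ _ _ _) = ≤-trans (tsize≤Σpsize Π) (sumTo-shift-≤ (depth Π) (psize Π₀))
tsize≤Σpsize Π₀@(!R Π _ _ _ _ _)     = ≤-trans (tsize≤Σpsize Π) (sumTo-shift-≤ (depth Π) (psize Π₀))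
tsize≤Σpsize (∀I Π _)   = tsize≤Σpsize Π
tsize≤Σpsize (∀E _ Π _) = tsize≤Σpsize Π

mainTheorem2 : ∀ {Γ Δ E M A} (Π : Deriv Γ Δ E M A) →
    (∀ d → d ≤ depth Π → width Π d ≤ psize Π d)
    × (tsize M ≤ sumTo (depth Π) (psize Π))
mainTheorem2 Π = (λ d _ → width≤psize Π d) , tsize≤Σpsize Π
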